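{- Let $a,b$ be relatively prime positive integers, $n\ge1$, let $P$ be an $(a,b)$-Dyck path of size $n$ with step sequence $\mathbf{u}=(u_1,\dots,u_{an})$, and let $w=\mu_b(\mathbf{u})=w_1w_2\cdots w_{abn}$ be the associated $b$-Stirling permutation. For $i\in[1,b]$ define the word $\nu^i=\nu^i_1\cdots\nu^i_{an}$ by $\nu^i_j=w_{(j-1)b+i}$. Then each $\nu^i$ is a permutation of $\{1,\dots,an\}$.
   Context: An $(a,b)$-Dyck path of size $n$ is a lattice path from $(0,0)$ to $(bn,an)$ with unit steps $N=(0,1)$, $E=(1,0)$ never going below $y=ax/b$; its step sequence is $(u_1,\dots,u_{an})$ with $u_k$ the $x$-coordinate of the $k$-th north step (so $u_k\le b(k-1)/a\le b(k-1)$). A $b$-Stirling permutation of size $m$ is a word in which each of $1,\dots,m$ occurs exactly $b$ times and, whenever $j$ occurs between two occurrences of $i$, $j>i$. The map $\mu_b$: for a sequence $(u_1,\dots,u_m)$ of nonnegative integers with $u_k\le b(k-1)$, start with the word $1^b$ and, for $k=2,\dots,m$, insert the block $k^b$ ($b$ consecutive copies of $k$) into the current word immediately after its first $u_k$ letters; $\mu_b(\mathbf{u})$ is the final word, a $b$-Stirling permutation of size $m$. -}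

module Defs where

open import Data.Nat using (ℕ; zero; suc; _+_; _*_; _∸_; _≤_)
open import Data.List using (List; []; _∷_; _++_; take; drop; replicate; inits; map; upTo)
open import Data.List.Relation.Unary.All using (All)
open import Data.Product using (_×_)
open import Relation.Binary.PropositionalEquality using (_≡_)

-- Unit steps of a lattice path: N = (0,1), E = (1,0).
data Step : Set where
  N E : Step

countN : List Step → ℕ
countN []      = 0
countN (N ∷ p) = suc (countN p)
countN (E ∷ p) = countN p

countE : List Step → ℕ
countE []      = 0
countE (N ∷ p) = countE p
countE (E ∷ p) = suc (countE p)

-- p is an (a,b)-Dyck path of size n: a path from (0,0) to (bn,an)
-- (a*n north steps, b*n east steps) all of whose lattice points (x,y)
-- (the endpoints of the prefixes) satisfy y ≥ a x / b, i.e. a*x ≤ b*y.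
IsDyckPath : ℕ → ℕ → ℕ → List Step → Set
IsDyckPath a b n p =
  (countN p ≡ a * n) × (countE p ≡ b * n) ×
  All (λ q → a * countE q ≤ b * countN q) (inits p)

-- Step sequence: u_k = x-coordinate of the k-th north step
-- (= number of east steps preceding it).
stepSeqFrom : ℕ → List Step → List ℕ
stepSeqFrom e []      = []
stepSeqFrom e (N ∷ p) = e ∷ stepSeqFrom e p
stepSeqFrom e (E ∷ p) = stepSeqFrom (suc e) p

stepSeq : List Step → List ℕ
stepSeq = stepSeqFrom 0

insertBlock : ℕ → ℕ → ℕ → List ℕ → List ℕ
insertBlock b k u w = take u w ++ replicate b k ++ drop u w

insertAll : ℕ → ℕ → List ℕ → List ℕ → List ℕ
insertAll b k w []       = w
insertAll b k w (u ∷ us) = insertAll b (suc k) (insertBlock b k u w) us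

-- μ_b(u_1,…,u_m): start from 1^b, then for k = 2..m insert k^b after
-- the first u_k letters.  (u_1 is ignored, as it is always 0.)
μ : ℕ → List ℕ → List ℕ
μ b []       = []
μ b (_ ∷ us) = insertAll b 2 (replicate b 1) us

-- 1-indexed letter w_i of a word (default 0 if out of range; 0 is not
-- a letter of any Stirling permutation, so this never helps the claim).
letter : List ℕ → ℕ → ℕ
letter []      _             = 0
letter (x ∷ w) 0             = 0
letter (x ∷ w) 1             = x
letter (x ∷ w) (suc (suc i)) = letter w (suc i)

ν : ℕ → ℕ → ℕ → List ℕ → List ℕ
ν b i m w = map (λ j → letter w (j * b + i)) (upTo m)

oneTo : ℕ → List ℕ
oneTo m = map suc (upTo m)

-- Inserting a block k^b of b consecutive letters into a word shifts every later
-- letter by exactly b positions, so it preserves the residue mod b of every old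
-- position, and the block itself covers each residue class exactly once. Hence
-- each ν^i, the subword of w at the positions ≡ i (mod b), gains exactly one new
-- letter k when k^b is inserted, and after the blocks 1^b, …, m^b it is a
-- permutation of 1, …, m. This holds for every sequence u: of the hypotheses on
-- P only the number a n of north steps (the length of u) is used.
module Submission where

open import Defs
open import Data.Nat using (ℕ; zero; suc; _+_; _*_; _∸_; _≤_; _<_; s≤s)
open import Data.Nat.Properties
  using (+-suc; +-assoc; +-comm; +-identityʳ; ≤-refl; ≤-trans; n≤1+n; m≤m+n; m+n∸m≡n;
         m≤n⇒∃[o]m+o≡n)
open import Data.Nat.Coprimality using (Coprime)
open import Data.List
  using (List; []; _∷_; _++_; [_]; take; drop; replicate; map; upTo; applyUpTo; length)
open import Data.List.Properties
  using (++-identityʳ; take++drop≡id; drop-drop; length-drop; length-++;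
         length-replicate; map-upTo; map-++; upTo-∷ʳ)
open import Data.List.Relation.Binary.Permutation.Propositional
  using (_↭_; ↭-refl; ↭-prep; module PermutationReasoning)
open import Data.List.Relation.Binary.Permutation.Propositional.Properties
  using (shift; shifts; ∷↭∷ʳ; ↭-length)
open import Data.Product using (_,_)
open import Relation.Binary.PropositionalEquality
  using (_≡_; refl; sym; trans; cong; cong₂; subst; module ≡-Reasoning)

-- column b' c w lists the letters of w at the 0-indexed positions c, c + b,
-- c + 2b, … where b = suc b'; the offset c counts down to the next letter taken.
column : ℕ → ℕ → List ℕ → List ℕ
column b' c       []      = []
column b' zero    (x ∷ w) = x ∷ column b' b' w
column b' (suc c) (x ∷ w) = column b' c w

columnOffset : ℕ → ℕ → List ℕ → ℕ
columnOffset b' c       []      = c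
columnOffset b' zero    (x ∷ w) = columnOffset b' b' w
columnOffset b' (suc c) (x ∷ w) = columnOffset b' c w

module _ {b' : ℕ} where

  column-++ : ∀ c xs ys →
    column b' c (xs ++ ys) ≡ column b' c xs ++ column b' (columnOffset b' c xs) ys
  column-++ c       []       ys = refl
  column-++ zero    (x ∷ xs) ys = cong (x ∷_) (column-++ b' xs ys)
  column-++ (suc c) (x ∷ xs) ys = column-++ c xs ys

  columnOffset-≤ : ∀ c xs → c ≤ b' → columnOffset b' c xs ≤ b'
  columnOffset-≤ c       []       c≤b' = c≤b'
  columnOffset-≤ zero    (x ∷ xs) _    = columnOffset-≤ b' xs ≤-refl
  columnOffset-≤ (suc c) (x ∷ xs) c≤b' = columnOffset-≤ c xs (≤-trans (n≤1+n c) c≤b')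

  column-drop : ∀ n c w → column b' (n + c) w ≡ column b' c (drop n w)
  column-drop zero    c w       = refl
  column-drop (suc n) c []      = refl
  column-drop (suc n) c (x ∷ w) = column-drop n c w

  column-replicate : ∀ n c k ys →
    column b' (n + c) (replicate n k ++ ys) ≡ column b' c ys
  column-replicate n c k ys = trans (column-drop n c _) (cong (column b' c) (drop-replicate n))
    where
    drop-replicate : ∀ n → drop n (replicate n k ++ ys) ≡ ys
    drop-replicate zero    = refl
    drop-replicate (suc n) = drop-replicate n

  column-block : ∀ c k ys → c ≤ b' →
    column b' c (replicate (suc b') k ++ ys) ≡ k ∷ column b' c ys
  column-block c k ys c≤b' with m≤n⇒∃[o]m+o≡n c≤b'
  ... | d , refl = begin
    column (c + d) c (k ∷ replicate (c + d) k ++ ys)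
      ≡⟨ cong (column (c + d) c) (replicate-suc c) ⟩
    column (c + d) c (replicate c k ++ k ∷ replicate d k ++ ys)
      ≡⟨ cong (λ e → column (c + d) e (replicate c k ++ k ∷ replicate d k ++ ys))
              (sym (+-identityʳ c)) ⟩
    column (c + d) (c + 0) (replicate c k ++ k ∷ replicate d k ++ ys)
      ≡⟨ column-replicate c 0 k _ ⟩
    k ∷ column (c + d) (c + d) (replicate d k ++ ys)
      ≡⟨ cong (λ e → k ∷ column (c + d) e (replicate d k ++ ys)) (+-comm c d) ⟩
    k ∷ column (c + d) (d + c) (replicate d k ++ ys)
      ≡⟨ cong (k ∷_) (column-replicate d c k ys) ⟩
    k ∷ column (c + d) c ys ∎
    where
    open ≡-Reasoning
    replicate-suc : ∀ c →
      k ∷ replicate (c + d) k ++ ys ≡ replicate c k ++ k ∷ replicate d k ++ ys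
    replicate-suc zero    = refl
    replicate-suc (suc c) = cong (k ∷_) (replicate-suc c)

  column-insertBlock : ∀ c k u w → c ≤ b' →
    column b' c (insertBlock (suc b') k u w) ↭ k ∷ column b' c w
  column-insertBlock c k u w c≤b' = begin
    column b' c (take u w ++ replicate (suc b') k ++ drop u w)
      ≡⟨ column-++ c (take u w) _ ⟩
    column b' c (take u w) ++ column b' c' (replicate (suc b') k ++ drop u w)
      ≡⟨ cong (column b' c (take u w) ++_)
              (column-block c' k (drop u w) (columnOffset-≤ c (take u w) c≤b')) ⟩
    column b' c (take u w) ++ [ k ] ++ column b' c' (drop u w)
      ↭⟨ shift k (column b' c (take u w)) _ ⟩
    k ∷ column b' c (take u w) ++ column b' c' (drop u w)
      ≡⟨ cong (k ∷_) (column-++ c (take u w) (drop u w)) ⟨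
    k ∷ column b' c (take u w ++ drop u w)
      ≡⟨ cong (λ v → k ∷ column b' c v) (take++drop≡id u w) ⟩
    k ∷ column b' c w ∎
    where
    open PermutationReasoning
    c' = columnOffset b' c (take u w)

oneTo-suc : ∀ m → oneTo (suc m) ↭ suc m ∷ oneTo m
oneTo-suc m = begin
  map suc (upTo (suc m))          ≡⟨ cong (map suc) (upTo-∷ʳ m) ⟨
  map suc (upTo m ++ [ m ])       ≡⟨ map-++ suc (upTo m) [ m ] ⟩
  oneTo m ++ [ suc m ]            ↭⟨ ∷↭∷ʳ (suc m) (oneTo m) ⟨
  suc m ∷ oneTo m                 ∎
  where open PermutationReasoning

module _ {b' c : ℕ} (c≤b' : c ≤ b') where

  column-insertAll : ∀ {j w} us → column b' c w ↭ oneTo j →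
    column b' c (insertAll (suc b') (suc j) w us) ↭ oneTo (j + length us)
  column-insertAll {j} []       col↭ rewrite +-identityʳ j = col↭
  column-insertAll {j} {w} (u ∷ us) col↭ rewrite +-suc j (length us) =
    column-insertAll us (begin
      column b' c (insertBlock (suc b') (suc j) u w) ↭⟨ column-insertBlock c (suc j) u w c≤b' ⟩
      suc j ∷ column b' c w                          ↭⟨ ↭-prep (suc j) col↭ ⟩
      suc j ∷ oneTo j                                ↭⟨ oneTo-suc j ⟨
      oneTo (suc j)                                  ∎)
    where open PermutationReasoning

  column-μ : ∀ us → column b' c (μ (suc b') us) ↭ oneTo (length us)
  column-μ []       = ↭-refl
  column-μ (_ ∷ us) = column-insertAll us (begin
    column b' c (replicate (suc b') 1)        ≡⟨ cong (column b' c) (++-identityʳ (replicate (suc b') 1)) ⟨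
    column b' c (replicate (suc b') 1 ++ [])  ≡⟨ column-block c 1 [] c≤b' ⟩
    oneTo 1                                   ∎)
    where open PermutationReasoning

insertBlock-↭ : ∀ b k u (w : List ℕ) → insertBlock b k u w ↭ replicate b k ++ w
insertBlock-↭ b k u w = begin
  take u w ++ replicate b k ++ drop u w   ↭⟨ shifts (take u w) (replicate b k) ⟩
  replicate b k ++ take u w ++ drop u w   ≡⟨ cong (replicate b k ++_) (take++drop≡id u w) ⟩
  replicate b k ++ w                      ∎
  where open PermutationReasoning

length-insertBlock : ∀ b k u (w : List ℕ) → length (insertBlock b k u w) ≡ b + length w
length-insertBlock b k u w = begin
  length (insertBlock b k u w)        ≡⟨ ↭-length (insertBlock-↭ b k u w) ⟩
  length (replicate b k ++ w)         ≡⟨ length-++ (replicate b k) ⟩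
  length (replicate b k) + length w   ≡⟨ cong (_+ length w) (length-replicate b) ⟩
  b + length w                        ∎
  where open ≡-Reasoning

length-insertAll : ∀ b k w us → length (insertAll b k w us) ≡ length us * b + length w
length-insertAll b k w []       = refl
length-insertAll b k w (u ∷ us) = begin
  length (insertAll b (suc k) (insertBlock b k u w) us)
    ≡⟨ length-insertAll b (suc k) _ us ⟩
  length us * b + length (insertBlock b k u w)
    ≡⟨ cong (length us * b +_) (length-insertBlock b k u w) ⟩
  length us * b + (b + length w)
    ≡⟨ +-assoc (length us * b) b (length w) ⟨
  length us * b + b + length w
    ≡⟨ cong (_+ length w) (+-comm (length us * b) b) ⟩
  b + length us * b + length w ∎
  where open ≡-Reasoning

length-μ : ∀ b us → length (μ b us) ≡ length us * b
length-μ b []       = refl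
length-μ b (_ ∷ us) = begin
  length (insertAll b 2 (replicate b 1) us)  ≡⟨ length-insertAll b 2 (replicate b 1) us ⟩
  length us * b + length (replicate b 1)     ≡⟨ cong (length us * b +_) (length-replicate b) ⟩
  length us * b + b                          ≡⟨ +-comm (length us * b) b ⟩
  b + length us * b                          ∎
  where open ≡-Reasoning

letter-drop : ∀ n w i → letter w (suc (n + i)) ≡ letter (drop n w) (suc i)
letter-drop zero    w       i = refl
letter-drop (suc n) []      i = refl
letter-drop (suc n) (x ∷ w) i = letter-drop n w i

drop-letter : ∀ c w → c < length w → drop c w ≡ letter w (suc c) ∷ drop (suc c) w
drop-letter zero    (x ∷ w) _         = refl
drop-letter (suc c) (x ∷ w) (s≤s c<w) = drop-letter c w c<w

module _ {b' c : ℕ} (c≤b' : c ≤ b') where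

  column-unfold : ∀ w → c < length w →
    column b' c w ≡ letter w (suc c) ∷ column b' c (drop (suc b') w)
  column-unfold w c<w with m≤n⇒∃[o]m+o≡n c≤b'
  ... | d , refl = begin
    column (c + d) c w
      ≡⟨ cong (λ e → column (c + d) e w) (+-identityʳ c) ⟨
    column (c + d) (c + 0) w
      ≡⟨ column-drop c 0 w ⟩
    column (c + d) 0 (drop c w)
      ≡⟨ cong (column (c + d) 0) (drop-letter c w c<w) ⟩
    letter w (suc c) ∷ column (c + d) (c + d) (drop (suc c) w)
      ≡⟨ cong (λ e → letter w (suc c) ∷ column (c + d) e (drop (suc c) w)) (+-comm c d) ⟩
    letter w (suc c) ∷ column (c + d) (d + c) (drop (suc c) w)
      ≡⟨ cong (letter w (suc c) ∷_) (column-drop d c (drop (suc c) w)) ⟩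
    letter w (suc c) ∷ column (c + d) c (drop d (drop (suc c) w))
      ≡⟨ cong (λ v → letter w (suc c) ∷ column (c + d) c v) (drop-drop (suc c) d w) ⟩
    letter w (suc c) ∷ column (c + d) c (drop (suc c + d) w) ∎
    where open ≡-Reasoning

  applyUpTo-letter≡column : ∀ m w (f : ℕ → ℕ) →
    (∀ j → f j ≡ letter w (j * suc b' + suc c)) → length w ≡ m * suc b' →
    applyUpTo f m ≡ column b' c w
  applyUpTo-letter≡column zero    []          f f≡ _   = refl
  applyUpTo-letter≡column (suc m) w@(_ ∷ _) f f≡ |w| = begin
    f 0 ∷ applyUpTo (λ j → f (suc j)) m
      ≡⟨ cong₂ _∷_ (f≡ 0)
           (applyUpTo-letter≡column m (drop b w) (λ j → f (suc j)) f∘suc≡ |drop-b-w|) ⟩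
    letter w (suc c) ∷ column b' c (drop b w)
      ≡⟨ column-unfold w c<|w| ⟨
    column b' c w ∎
    where
    open ≡-Reasoning
    b = suc b'
    c<|w| : c < length w
    c<|w| = subst (c <_) (sym |w|) (≤-trans (s≤s c≤b') (m≤m+n b (m * b)))
    f∘suc≡ : ∀ j → f (suc j) ≡ letter (drop b w) (j * b + suc c)
    f∘suc≡ j = begin
      f (suc j)                                  ≡⟨ f≡ (suc j) ⟩
      letter w (b + j * b + suc c)               ≡⟨ cong (letter w) (+-assoc b (j * b) (suc c)) ⟩
      letter w (b + (j * b + suc c))             ≡⟨ cong (λ e → letter w (b + e)) (+-suc (j * b) c) ⟩
      letter w (b + suc (j * b + c))             ≡⟨ cong (letter w) (+-suc b (j * b + c)) ⟩
      letter w (suc (b + (j * b + c)))           ≡⟨ letter-drop b w (j * b + c) ⟩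
      letter (drop b w) (suc (j * b + c))        ≡⟨ cong (letter (drop b w)) (+-suc (j * b) c) ⟨
      letter (drop b w) (j * b + suc c)          ∎
    |drop-b-w| : length (drop b w) ≡ m * b
    |drop-b-w| = trans (length-drop b w) (trans (cong (_∸ b) |w|) (m+n∸m≡n b (m * b)))

  ν≡column : ∀ m w → length w ≡ m * suc b' → ν (suc b') (suc c) m w ≡ column b' c w
  ν≡column m w |w| =
    trans (map-upTo _ m) (applyUpTo-letter≡column m w _ (λ _ → refl) |w|)

  ν-μ : ∀ us → ν (suc b') (suc c) (length us) (μ (suc b') us) ↭ oneTo (length us)
  ν-μ us = subst (_↭ oneTo (length us))
    (sym (ν≡column (length us) (μ (suc b') us) (length-μ (suc b') us))) (column-μ c≤b' us)

length-stepSeqFrom : ∀ e P → length (stepSeqFrom e P) ≡ countN P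
length-stepSeqFrom e []      = refl
length-stepSeqFrom e (N ∷ P) = cong suc (length-stepSeqFrom e P)
length-stepSeqFrom e (E ∷ P) = length-stepSeqFrom (suc e) P

mainTheorem4 : (a b n : ℕ) → 1 ≤ a → 1 ≤ b → Coprime a b → 1 ≤ n →
    (P : List Step) → IsDyckPath a b n P →
    (i : ℕ) → 1 ≤ i → i ≤ b →
    ν b i (a * n) (μ b (stepSeq P)) ↭ oneTo (a * n)
mainTheorem4 a (suc b') n _ _ _ _ P (#N≡an , _) (suc c) _ (s≤s c≤b') =
  subst (λ m → ν (suc b') (suc c) m (μ (suc b') (stepSeq P)) ↭ oneTo m)
    (trans (length-stepSeqFrom 0 P) #N≡an) (ν-μ c≤b' (stepSeq P))
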